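{- Let $T$ be a tree with $\operatorname{diam}(T)=5$ and let $T\overline{T}$ be its complementary prism. If $u,v,w$ are three distinct vertices of $T$ such that one of them is adjacent in $T$ to the other two, then $V(\overline{T})\subseteq [\{\overline{u},\overline{v},\overline{w}\}]_{T\overline{T}}$.
   Context: For a graph $G$ with complement $\overline{G}$, the complementary prism $G\overline{G}$ is the graph obtained from the disjoint union of $G$ and $\overline{G}$ by adding the perfect matching joining each vertex $v$ of $G$ to its copy $\overline{v}$ in $\overline{G}$. For a graph $H$, a set $S\subseteq V(H)$ is (geodesically) convex if every vertex on every shortest path between two vertices of $S$ belongs to $S$; the convex hull $[S]_H$ is the smallest convex set of $H$ containing $S$. -}

module Defs where

open import Level using (0ℓ)
open import Data.Nat using (ℕ; zero; suc; _≤_)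
open import Data.Fin using (Fin)
open import Data.Sum using (_⊎_; inj₁; inj₂)
open import Data.Product using (Σ; ∃; ∃-syntax; _×_; _,_)
open import Data.List using (List; []; _∷_)
open import Data.List.Relation.Unary.Unique.Propositional using (Unique)
open import Relation.Nullary using (¬_)
open import Relation.Unary using (Pred; _∈_; _⊆_)
open import Relation.Binary using (Rel; Decidable)
open import Relation.Binary.PropositionalEquality using (_≡_; _≢_)

record SimpleGraph (n : ℕ) : Set₁ where
  field
    Adj    : Fin n → Fin n → Set
    adj?   : Decidable Adj
    sym    : ∀ {x y} → Adj x y → Adj y x
    irrefl : ∀ {x} → ¬ Adj x x
open SimpleGraph public

data Walk {V : Set} (E : Rel V 0ℓ) : V → V → ℕ → Set where
  nil  : (x : V) → Walk E x x zero
  cons : ∀ {x y z k} → E x y → Walk E y z k → Walk E x z (suc k)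

verts : ∀ {V : Set} {E : Rel V 0ℓ} {x y k} → Walk E x y k → List V
verts (nil x) = x ∷ []
verts (cons {x = x} _ w) = x ∷ verts w

data OnWalk {V : Set} {E : Rel V 0ℓ} (v : V) : ∀ {x y k} → Walk E x y k → Set where
  here  : ∀ {y k} (w : Walk E v y k) → OnWalk v w
  there : ∀ {x y z k} (e : E x y) {w : Walk E y z k} → OnWalk v w → OnWalk v (cons e w)

Geodesic : ∀ {V : Set} {E : Rel V 0ℓ} {x y k} → Walk E x y k → Set
Geodesic {E = E} {x} {y} {k} _ = ∀ k′ → Walk E x y k′ → k ≤ k′

Dist : ∀ {V : Set} (E : Rel V 0ℓ) → V → V → ℕ → Set
Dist E x y d = Σ (Walk E x y d) Geodesic

Convex : ∀ {V : Set} (E : Rel V 0ℓ) → Pred V 0ℓ → Set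
Convex E C = ∀ {x y k} (w : Walk E x y k) → x ∈ C → y ∈ C → Geodesic w →
             ∀ v → OnWalk v w → v ∈ C

Hull : ∀ {V : Set} (E : Rel V 0ℓ) → Pred V 0ℓ → Pred V (Level.suc 0ℓ)
Hull {V} E S v = ∀ (C : Pred V 0ℓ) → Convex E C → S ⊆ C → v ∈ C

Connected : ∀ {n} → SimpleGraph n → Set
Connected G = ∀ x y → ∃[ k ] Walk (Adj G) x y k

HasCycle : ∀ {n} → SimpleGraph n → Set
HasCycle G = ∃[ x ] ∃[ y ] ∃[ k ] Σ (Walk (Adj G) x y (suc (suc k))) λ w →
             Unique (verts w) × Adj G y x

IsTree : ∀ {n} → SimpleGraph n → Set
IsTree G = Connected G × ¬ HasCycle G

HasDiameter : ∀ {n} → SimpleGraph n → ℕ → Set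
HasDiameter G D = (∀ x y → ∃[ d ] Dist (Adj G) x y d × d ≤ D)
                × (∃[ x ] ∃[ y ] Dist (Adj G) x y D)

-- Complementary prism: vertices inj₁ v (copy in G) and inj₂ v (copy v̄ in the complement).
PrismAdj : ∀ {n} → SimpleGraph n → Rel (Fin n ⊎ Fin n) 0ℓ
PrismAdj G (inj₁ a) (inj₁ b) = Adj G a b
PrismAdj G (inj₂ a) (inj₂ b) = a ≢ b × ¬ Adj G a b
PrismAdj G (inj₁ a) (inj₂ b) = a ≡ b
PrismAdj G (inj₂ a) (inj₁ b) = a ≡ b

Triple : ∀ {V : Set} → V → V → V → Pred V 0ℓ
Triple x y z v = v ≡ x ⊎ v ≡ y ⊎ v ≡ z

module Submission where

-- Let u be adjacent to v and w in a tree T of diameter 5, and let C be a convex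
-- set of the complementary prism T T̄ containing ū, v̄, w̄.  Write "z is good" for
-- z̄ ∈ C.  The engine is one observation: if ab is an edge of T with a, b good,
-- then ā z̄ b̄ is a shortest path for every z at distance ≥ 2 from a and from b,
-- so z is good (complement-rule).
--   1. Every z at distance ≥ 2 from u is good: it misses the closed
--      neighbourhood of v or of w, since otherwise u v z w would be a 4-cycle.
--   2. Let x be adjacent to u and p0 p1 … p5 a diametral path.  If p0, p1 (or
--      p4, p5) both avoid the closed neighbourhood B of the edge ux, they are
--      good by step 1 and x is good by the rule.  Otherwise one end of each end
--      edge lies in B; as points of B are within distance 3 of each other, the
--      geodesic forces p1 ~ u and p4 ~ x (or symmetrically), and x is good by
--      a detour: p4, p5 give p1, then p1, p0 give x.

open import Defs
open import Level using (0ℓ)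
open import Data.Nat using (ℕ; suc; _≤_; z≤n; s≤s; s≤s⁻¹)
open import Data.Nat.Properties using (<⇒≤; 1+n≰n)
open import Data.Fin using (Fin; _≟_)
open import Data.Sum using (_⊎_; inj₁; inj₂)
open import Data.Product using (Σ; _×_; _,_; proj₁)
open import Data.List.Relation.Unary.Unique.Propositional using (Unique)
open import Data.List.Relation.Unary.All using ([]; _∷_)
open import Data.List.Relation.Unary.AllPairs using ([]; _∷_)
open import Data.Empty using (⊥-elim)
open import Relation.Nullary using (¬_; yes; no)
open import Relation.Unary using (Pred; _∈_)
open import Relation.Binary using (Rel)
open import Relation.Binary.PropositionalEquality using (_≡_; _≢_; refl; ≢-sym)

no-short-walk : ∀ {V : Set} {E : Rel V 0ℓ} {a b : V} → a ≢ b → ¬ E a b →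
                ∀ {j} → Walk E a b j → 2 ≤ j
no-short-walk a≢b ¬ab (nil _) = ⊥-elim (a≢b refl)
no-short-walk a≢b ¬ab (cons e (nil _)) = ⊥-elim (¬ab e)
no-short-walk a≢b ¬ab (cons _ (cons _ _)) = s≤s (s≤s z≤n)

convex-common-neighbour : ∀ {V : Set} {E : Rel V 0ℓ} {C : Pred V 0ℓ} {a b z : V} →
                          Convex E C → a ∈ C → b ∈ C → a ≢ b → ¬ E a b →
                          E a z → E z b → z ∈ C
convex-common-neighbour cvx Ca Cb a≢b ¬ab az zb =
  cvx (cons az (cons zb (nil _))) Ca Cb (λ _ → no-short-walk a≢b ¬ab) _ (there az (here _))

module Distance {n : ℕ} (G : SimpleGraph n) where

  A : Fin n → Fin n → Set
  A = Adj G

  private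
    variable
      a b c : Fin n
      k : ℕ

  adj⇒≢ : A a b → a ≢ b
  adj⇒≢ ab refl = irrefl G ab

  snoc : Walk A a b k → A b c → Walk A a c (suc k)
  snoc (nil _) e = cons e (nil _)
  snoc (cons e′ w) e = cons e′ (snoc w e)

  reverse : Walk A a b k → Walk A b a k
  reverse (nil _) = nil _
  reverse (cons e w) = snoc (reverse w) (sym G e)

  Far : Fin n → Fin n → ℕ → Set
  Far a b k = ∀ {j} → Walk A a b j → k ≤ j

  far-sym : Far a b k → Far b a k
  far-sym far w = far (reverse w)

  far-pred : Far a b (suc k) → Far a b k
  far-pred far w = <⇒≤ (far w)

  -- Distance at least 2 means distinct and non-adjacent: the complement edge.
  far₂-inv : Far a b 2 → a ≢ b × ¬ A a b
  far₂-inv far = (λ { refl → 1+n≰n (far-pred far (nil _)) }) , λ e → 1+n≰n (far (cons e (nil _)))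

  data Near (a : Fin n) : Fin n → Set where
    same : Near a a
    step : ∀ {b} → A a b → Near a b

  near-left : Near a b → Far b c (suc k) → Far a c k
  near-left same far = far-pred far
  near-left (step ab) far w = s≤s⁻¹ (far (cons (sym G ab) w))

  near-right : Near c b → Far a b (suc k) → Far a c k
  near-right same far = far-pred far
  near-right (step cb) far w = s≤s⁻¹ (far (snoc w cb))

  near? : ∀ a b → Near a b ⊎ Far a b 2
  near? a b with a ≟ b
  ... | yes refl = inj₁ same
  ... | no a≢b with adj? G a b
  ...   | yes ab = inj₁ (step ab)
  ...   | no ¬ab = inj₂ (no-short-walk a≢b ¬ab)

common-neighbour-unique : ∀ {n} (G : SimpleGraph n) → ¬ HasCycle G →
                          {u v w z : Fin n} → Adj G u v → Adj G u w → v ≢ w →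
                          Adj G z v → Adj G z w → z ≡ u
common-neighbour-unique G acyc {u} {v} {w} {z} uv uw v≢w zv zw with z ≟ u
... | yes z≡u = z≡u
... | no z≢u = ⊥-elim (acyc (u , w , 1 , square , distinct , sym G uw))
  where
    open Distance G using (adj⇒≢)
    square : Walk (Adj G) u w 3
    square = cons uv (cons (sym G zv) (cons zw (nil w)))
    distinct : Unique (verts square)
    distinct = (adj⇒≢ uv ∷ ≢-sym z≢u ∷ adj⇒≢ uw ∷ [])
             ∷ (≢-sym (adj⇒≢ zv) ∷ v≢w ∷ [])
             ∷ (adj⇒≢ zw ∷ [])
             ∷ [] ∷ []

module Prism {n : ℕ} (G : SimpleGraph n) (C : Pred (Fin n ⊎ Fin n) 0ℓ)
             (cvx : Convex (PrismAdj G) C) where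
  open Distance G

  Good : Fin n → Set
  Good z = inj₂ z ∈ C

  -- If ab is an edge with ā, b̄ ∈ C and z is at distance ≥ 2 from a and b,
  -- then ā and b̄ are at distance 2 in the prism with common neighbour z̄.
  complement-rule : ∀ {a b z} → A a b → Good a → Good b → Far a z 2 → Far z b 2 → Good z
  complement-rule ab Ga Gb az zb =
    convex-common-neighbour cvx Ga Gb (λ { refl → irrefl G ab }) (λ (_ , ¬ab) → ¬ab ab)
                            (far₂-inv az) (far₂-inv zb)

module Centre {n : ℕ} (T : SimpleGraph n) (acyc : ¬ HasCycle T)
              (C : Pred (Fin n ⊎ Fin n) 0ℓ) (cvx : Convex (PrismAdj T) C)
              {u v w : Fin n} (uv : Adj T u v) (uw : Adj T u w) (v≢w : v ≢ w)
              (Gu : inj₂ u ∈ C) (Gv : inj₂ v ∈ C) (Gw : inj₂ w ∈ C) where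
  open Distance T
  open Prism T C cvx

  far-from-centre : ∀ {z} → Far u z 2 → Good z
  far-from-centre {z} fuz with near? v z | near? w z
  ... | inj₁ same | _ = Gv
  ... | _ | inj₁ same = Gw
  ... | inj₂ fvz | _ = complement-rule uv Gu Gv fuz (far-sym fvz)
  ... | _ | inj₂ fwz = complement-rule uw Gu Gw fuz (far-sym fwz)
  ... | inj₁ (step vz) | inj₁ (step wz) =
    ⊥-elim (≢-sym (proj₁ (far₂-inv fuz))
              (common-neighbour-unique T acyc uv uw v≢w (sym T vz) (sym T wz)))

  module Neighbour {x : Fin n} (ux : A u x) where

    data Side : Set where
      atU atX : Side

    centre : Side → Fin n
    centre atU = u
    centre atX = x

    InBall : Fin n → Set
    InBall z = Σ Side λ s → Near (centre s) z

    Outside : Fin n → Set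
    Outside z = Far u z 2 × Far x z 2

    inBall? : ∀ z → InBall z ⊎ Outside z
    inBall? z with near? u z | near? x z
    ... | inj₁ nu | _ = inj₁ (atU , nu)
    ... | _ | inj₁ nx = inj₁ (atX , nx)
    ... | inj₂ fu | inj₂ fx = inj₂ (fu , fx)

    -- The only pairs of B at distance 3: a neighbour of u and a neighbour of x.
    Special : Fin n → Fin n → Set
    Special a b = (A u a × A x b) ⊎ (A x a × A u b)

    special-walk : ∀ {a b} → Special a b → Walk A a b 3
    special-walk (inj₁ (ua , xb)) = cons (sym T ua) (cons ux (cons xb (nil _)))
    special-walk (inj₂ (xa , ub)) = cons (sym T xa) (cons (sym T ux) (cons ub (nil _)))

    centres-close : ∀ s s′ → ¬ Far (centre s) (centre s′) 2
    centres-close atU atU far = 1+n≰n (far-pred far (nil u))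
    centres-close atU atX far = 1+n≰n (far (cons ux (nil x)))
    centres-close atX atU far = 1+n≰n (far (cons (sym T ux) (nil u)))
    centres-close atX atX far = 1+n≰n (far-pred far (nil x))

    opposite-sides : ∀ s s′ {a b} → A (centre s) a → A (centre s′) b →
                     Far (centre s) (centre s′) 1 → Special a b
    opposite-sides atU atU _ _ far = ⊥-elim (1+n≰n (far (nil u)))
    opposite-sides atU atX ua xb _ = inj₁ (ua , xb)
    opposite-sides atX atU xa ub _ = inj₂ (xa , ub)
    opposite-sides atX atX _ _ far = ⊥-elim (1+n≰n (far (nil x)))

    ball-distance : ∀ {a b} → InBall a → InBall b → Far a b 3 → Special a b
    ball-distance (s , same) (s′ , nb) far = ⊥-elim (centres-close s s′ (near-right nb far))
    ball-distance (s , step e) (s′ , same) far =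
      ⊥-elim (centres-close s s′ (near-left (step e) far))
    ball-distance (s , step e) (s′ , step e′) far =
      opposite-sides s s′ e e′ (near-right (step e′) (near-left (step e) far))

    ball-far4 : ∀ {a b} → InBall a → InBall b → ¬ Far a b 4
    ball-far4 ba bb far = 1+n≰n (far (special-walk (ball-distance ba bb (far-pred far))))

    edge-or-ball : ∀ {a b} → A a b → Good x ⊎ (InBall a ⊎ InBall b)
    edge-or-ball {a} {b} ab with inBall? a | inBall? b
    ... | inj₁ ba | _ = inj₂ (inj₁ ba)
    ... | _ | inj₁ bb = inj₂ (inj₂ bb)
    ... | inj₂ (ua , xa) | inj₂ (ub , xb) =
      inj₁ (complement-rule ab (far-from-centre ua) (far-from-centre ub) (far-sym xa) xb)

    -- The special case of a diametral path q0 q1 … q5 with q1 ~ u and q4 ~ x: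
    -- q4, q5 are good and far from q1, so q1 is good; then q1, q0 make x good.
    detour : ∀ {q0 q1 q4 q5} → A q0 q1 → A q4 q5 → Far q0 q5 5 →
             A u q1 → A x q4 → Good x
    detour {q0} {q1} {q4} {q5} e01 e45 far05 uq1 xq4 =
      complement-rule (sym T e01) good-q1 good-q0 (near-right (step xq4) far14)
                      (far-sym (far-pred far0x))
      where
        far15 : Far q1 q5 4
        far15 = near-left (step (sym T e01)) far05
        far14 : Far q1 q4 3
        far14 = near-right (step e45) far15
        far0x : Far q0 x 3
        far0x = near-right (step xq4) (near-right (step e45) far05)
        good-q1 : Good q1
        good-q1 = complement-rule e45 (far-from-centre (near-left (step uq1) far14))
                    (far-from-centre (far-pred (near-left (step uq1) far15)))
                    (far-sym (far-pred far14)) (far-pred (far-pred far15))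
        good-q0 : Good q0
        good-q0 = far-from-centre (far-sym (near-right (step ux) far0x))

    neighbour-good : ∀ {p0 p1 p4 p5} → A p0 p1 → A p4 p5 → Far p0 p5 5 → Good x
    neighbour-good e01 e45 far05 with edge-or-ball e01 | edge-or-ball e45
    ... | inj₁ good | _ = good
    ... | _ | inj₁ good = good
    ... | inj₂ (inj₁ b0) | inj₂ (inj₁ b4) = ⊥-elim (ball-far4 b0 b4 (near-right (step e45) far05))
    ... | inj₂ (inj₁ b0) | inj₂ (inj₂ b5) = ⊥-elim (ball-far4 b0 b5 (far-pred far05))
    ... | inj₂ (inj₂ b1) | inj₂ (inj₂ b5) = ⊥-elim (ball-far4 b1 b5 (near-left (step (sym T e01)) far05))
    ... | inj₂ (inj₂ b1) | inj₂ (inj₁ b4)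
        with ball-distance b1 b4 (near-right (step e45) (near-left (step (sym T e01)) far05))
    ...   | inj₁ (uq1 , xq4) = detour e01 e45 far05 uq1 xq4
    ...   | inj₂ (xq1 , uq4) = detour (sym T e45) (sym T e01) (far-sym far05) uq4 xq1

  all-good : ∀ {p q} → Dist A p q 5 → ∀ x → Good x
  all-good (cons e01 (cons _ (cons _ (cons _ (cons e45 (nil _))))) , geo) x with near? u x
  ... | inj₁ same = Gu
  ... | inj₁ (step ux) = Neighbour.neighbour-good ux e01 e45 (λ w → geo _ w)
  ... | inj₂ fux = far-from-centre fux

lemma3p5 : ∀ {n} (T : SimpleGraph n) → IsTree T → HasDiameter T 5 →
           (u v w : Fin n) → u ≢ v → u ≢ w → v ≢ w →
           (Adj T u v × Adj T u w) ⊎ (Adj T v u × Adj T v w) ⊎ (Adj T w u × Adj T w v) →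
           ∀ x → Hull (PrismAdj T) (Triple (inj₂ u) (inj₂ v) (inj₂ w)) (inj₂ x)
lemma3p5 T (_ , acyc) (_ , _ , _ , diam) u v w u≢v u≢w v≢w central x C cvx S⊆C =
  from-centre central
  where
    Cu : inj₂ u ∈ C
    Cu = S⊆C (inj₁ refl)
    Cv : inj₂ v ∈ C
    Cv = S⊆C (inj₂ (inj₁ refl))
    Cw : inj₂ w ∈ C
    Cw = S⊆C (inj₂ (inj₂ refl))
    from-centre : (Adj T u v × Adj T u w) ⊎ (Adj T v u × Adj T v w) ⊎ (Adj T w u × Adj T w v) →
                  inj₂ x ∈ C
    from-centre (inj₁ (uv , uw)) = Centre.all-good T acyc C cvx uv uw v≢w Cu Cv Cw diam x
    from-centre (inj₂ (inj₁ (vu , vw))) = Centre.all-good T acyc C cvx vu vw u≢w Cv Cu Cw diam x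
    from-centre (inj₂ (inj₂ (wu , wv))) = Centre.all-good T acyc C cvx wu wv u≢v Cw Cu Cv diam x
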